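{- For every natural number $M\geq 3$ there exists a $2$-coloring of all walks from $[M]$ to $[3]$ such that for each walk $t\colon[M]\to[6]$ the set \[ \{ s\circ t\colon s\colon[6]\to[3]\text{ a walk}\} \] is not monochromatic.
   Context: $[N]=\{1,\dots,N\}$. A walk is a surjection $s\colon[L]\to[K]$ (onto $[K]$) such that $s(1)=1$ and $|s(i)-s(j)|\leq1$ whenever $i,j\in[L]$ and $|i-j|\leq1$. Here $s\circ t$ denotes composition of functions (for $t$ onto $[6]$ and $s$ defined on $[6]$ this is the ordinary composition). -}

module Defs where

open import Data.Nat using (ℕ; _≤_; ∣_-_∣)
open import Data.Fin using (Fin; toℕ)
open import Data.Product using (Σ; _×_; ∃)
open import Relation.Binary.PropositionalEquality using (_≡_)

-- [N] = {1,…,N} is represented by Fin N, where the element i ∈ [N]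
-- corresponds to the index with toℕ = i - 1.

record IsWalk {L K : ℕ} (s : Fin L → Fin K) : Set where
  field
    onto     : ∀ (k : Fin K) → ∃ λ (i : Fin L) → s i ≡ k
    start    : ∀ (i : Fin L) → toℕ i ≡ 0 → toℕ (s i) ≡ 0
    lipschitz : ∀ (i j : Fin L) → ∣ toℕ i - toℕ j ∣ ≤ 1 → ∣ toℕ (s i) - toℕ (s j) ∣ ≤ 1

Monochromatic : {M : ℕ} → ((Fin M → Fin 3) → Fin 2) → (Fin M → Fin 6) → Set
Monochromatic {M} c t =
  ∀ (s₁ s₂ : Fin 6 → Fin 3) → IsWalk s₁ → IsWalk s₂ →
    c (λ i → s₁ (t i)) ≡ c (λ i → s₂ (t i))

module Submission where

-- Idea of the proof (all values are 0-based, so [3] = {0,1,2}, [6] = {0,…,5}).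
--
-- Colour a walk w into [3] by the parity of the number of steps 1 → 0 it
-- takes before it first reaches the top value 2.  Four test walks
-- s₀,…,s₃ : [6] → [3] are used: each sends 0 ↦ 0, 3 ↦ 1 and 4, 5 ↦ 2, and
-- the values at 1 and 2 run through all four patterns in {0,1}².
--
-- Let t be a walk onto [6].  Before t first reaches 4 it stays in {0,…,3},
-- where no test walk takes the value 2, and at the moment it reaches 4
-- every sₖ ∘ t reaches 2.  A finite check shows that for one step a → b
-- inside {0,…,3} the number of test walks performing a step 1 → 0 is odd
-- exactly when the step crosses between {0,1} and {2,3}.  Since t starts
-- in {0,1} and enters 4 from 3, it crosses an odd number of times, so the
-- four colours of the sₖ ∘ t have odd sum in ℤ/2 (lemma hitting-parity).
-- Four equal colours have even sum, so they are never all equal.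

open import Defs
open import Algebra.Bundles using (CommutativeRing)
open import Data.Bool using (Bool; true; false; not; _xor_)
import Data.Bool.Properties as Bool
open import Data.Empty using (⊥-elim)
open import Data.Fin using (Fin; toℕ; inject₁; _≟_)
open import Data.Fin.Patterns using (0F; 1F; 2F; 3F; 4F; 5F)
open import Data.Fin.Properties using (toℕ-inject₁; all?; any?; 2↔Bool)
open import Data.Nat using (ℕ; zero; suc; _≥_; _≤_; _<_; z≤n; s≤s; ∣_-_∣)
open import Data.Nat.Properties using (_≤?_; _<?_; <-irrefl)
import Data.Nat.Properties as ℕ
open import Data.Product using (Σ; _×_; _,_; ∃)
open import Data.Sum using (_⊎_; inj₁; inj₂)
open import Data.Unit using (⊤; tt)
open import Data.Vec.Functional using (Vector; head; tail; _∷_; [])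
open import Function using (_∘_; Inverse)
open import Relation.Binary.PropositionalEquality
  using (_≡_; _≢_; refl; sym; trans; cong; cong₂; subst; module ≡-Reasoning)
open import Relation.Nullary using (¬_; Dec)
open import Relation.Nullary.Decidable
  using (map′; from-yes; ¬?; _×-dec_; _→-dec_; _⊎-dec_)

open import Algebra.Properties.CommutativeMonoid.Sum
  (CommutativeRing.+-commutativeMonoid Bool.xor-∧-commutativeRing)
  using (sum; sum-syntax; sum-cong-≗; ∑-distrib-+)

private
  variable
    n K : ℕ

Adjacent : Fin K → Fin K → Set
Adjacent a b = ∣ toℕ a - toℕ b ∣ ≤ 1

adjacent? : (a b : Fin K) → Dec (Adjacent a b)
adjacent? a b = ∣ toℕ a - toℕ b ∣ ≤? 1

adjacent-suc : ∀ m → ∣ m - suc m ∣ ≤ 1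
adjacent-suc zero    = s≤s z≤n
adjacent-suc (suc m) = adjacent-suc m

PathFrom : Fin K → Vector (Fin K) n → Set
PathFrom {n = zero}  p f = ⊤
PathFrom {n = suc n} p f = Adjacent p (head f) × PathFrom (head f) (tail f)

consecutive⇒path : (f : Vector (Fin K) (suc n)) →
  (∀ i → Adjacent (f (inject₁ i)) (f (Fin.suc i))) → PathFrom (head f) (tail f)
consecutive⇒path {n = zero}  f adj = tt
consecutive⇒path {n = suc n} f adj = adj 0F , consecutive⇒path (tail f) (adj ∘ Fin.suc)

walk⇒path : ∀ {L} {t : Fin L → Fin (suc K)} → IsWalk t → PathFrom 0F t
walk⇒path {L = zero}          w = tt
walk⇒path {L = suc L} {t = t} w =
  subst (λ v → ∣ 0 - v ∣ ≤ 1) (sym (IsWalk.start w 0F refl)) z≤n ,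
  consecutive⇒path t (λ i → IsWalk.lipschitz w (inject₁ i) (Fin.suc i) (indices-adjacent i))
  where
  indices-adjacent : (i : Fin L) → ∣ toℕ (inject₁ i) - toℕ (Fin.suc i) ∣ ≤ 1
  indices-adjacent i rewrite toℕ-inject₁ i = adjacent-suc (toℕ i)

isWalk? : ∀ {L} (s : Fin L → Fin K) → Dec (IsWalk s)
isWalk? s = map′
  (λ (o , st , lip) → record { onto = o ; start = st ; lipschitz = lip })
  (λ w → IsWalk.onto w , IsWalk.start w , IsWalk.lipschitz w)
  (all? (λ k → any? (λ i → s i ≟ k)) ×-dec
   all? (λ i → toℕ i ℕ.≟ 0 →-dec toℕ (s i) ℕ.≟ 0) ×-dec
   all? (λ i → all? (λ j → adjacent? i j →-dec adjacent? (s i) (s j))))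

Visits : Fin K → Vector (Fin K) n → Set
Visits a f = ∃ λ i → f i ≡ a

visits-tail : {a : Fin K} (f : Vector (Fin K) (suc n)) →
  Visits a f → head f ≢ a → Visits a (tail f)
visits-tail f (0F        , fi≡a) head≢a = ⊥-elim (head≢a fi≡a)
visits-tail f (Fin.suc i , fi≡a) head≢a = i , fi≡a

descent : Fin 3 → Fin 3 → Bool
descent 1F 0F = true
descent _  _  = false

-- Update of the parity of the remaining steps r by a preceding step q → x;
-- a step to 2 resets it, so only steps before the first visit to 2 count.
parityStep : Fin 3 → Fin 3 → Bool → Bool
parityStep q 2F r = false
parityStep q x  r = descent q x xor r

parityFrom : Fin 3 → Vector (Fin 3) n → Bool
parityFrom {n = zero}  q w = false
parityFrom {n = suc n} q w = parityStep q (head w) (parityFrom (head w) (tail w))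

parityStep-low : ∀ q {x} r → x ≢ 2F → parityStep q x r ≡ descent q x xor r
parityStep-low q {0F} r _   = refl
parityStep-low q {1F} r _   = refl
parityStep-low q {2F} r x≢2 = ⊥-elim (x≢2 refl)

fromBool : Bool → Fin 2
fromBool = Inverse.from 2↔Bool

fromBool-injective : ∀ {a b} → fromBool a ≡ fromBool b → a ≡ b
fromBool-injective {a} {b} eq = begin
  a                                  ≡⟨ sym (Inverse.strictlyInverseˡ 2↔Bool a) ⟩
  Inverse.to 2↔Bool (fromBool a)    ≡⟨ cong (Inverse.to 2↔Bool) eq ⟩
  Inverse.to 2↔Bool (fromBool b)    ≡⟨ Inverse.strictlyInverseˡ 2↔Bool b ⟩
  b                                  ∎
  where open ≡-Reasoning

colour : ∀ {M} → Vector (Fin 3) M → Fin 2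
colour w = fromBool (parityFrom 0F w)

first second : Vector (Fin 3) 4
first  = 0F ∷ 0F ∷ 1F ∷ 1F ∷ []
second = 0F ∷ 1F ∷ 1F ∷ 0F ∷ []

test : Fin 4 → Fin 6 → Fin 3
test k = 0F ∷ first k ∷ second k ∷ 1F ∷ 2F ∷ 2F ∷ []

test-walk : ∀ k → IsWalk (test k)
test-walk = from-yes (all? (λ k → isWalk? (test k)))

high : Fin 6 → Bool
high 0F = false
high 1F = false
high _  = true

test-low : ∀ k y → toℕ y < 4 → test k y ≢ 2F
test-low = from-yes (all? (λ k → all? (λ y → toℕ y <? 4 →-dec ¬? (test k y ≟ 2F))))

step-from-below : ∀ p y → toℕ p < 4 → Adjacent p y →
  toℕ y < 4 ⊎ (y ≡ 4F × high p ≡ true)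
step-from-below = from-yes (all? (λ p → all? (λ y →
  toℕ p <? 4 →-dec adjacent? p y →-dec
  (toℕ y <? 4 ⊎-dec (y ≟ 4F ×-dec high p Bool.≟ true)))))

crossing : ∀ a b → toℕ a < 4 → toℕ b < 4 → Adjacent a b →
  ∑[ k < 4 ] descent (test k a) (test k b) ≡ high a xor high b
crossing = from-yes (all? (λ a → all? (λ b →
  toℕ a <? 4 →-dec toℕ b <? 4 →-dec adjacent? a b →-dec
  (∑[ k < 4 ] descent (test k a) (test k b)) Bool.≟ (high a xor high b))))

testParity : Fin 6 → Vector (Fin 6) n → Bool
testParity p f = ∑[ k < 4 ] parityFrom (test k p) (test k ∘ f)

-- Entering 4 sends every test walk to the top, which resets all parities.
entering-top : ∀ p (f : Vector (Fin 6) (suc n)) → head f ≡ 4F → testParity p f ≡ false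
entering-top p f head≡4 = cong
  (λ y → ∑[ k < 4 ] parityStep (test k p) (test k y) (parityFrom (test k y) (test k ∘ tail f)))
  head≡4

xor-not-cancel : ∀ a b → (a xor b) xor not b ≡ not a
xor-not-cancel false false = refl
xor-not-cancel false true  = refl
xor-not-cancel true  false = refl
xor-not-cancel true  true  = refl

hitting-parity : ∀ p (f : Vector (Fin 6) n) → toℕ p < 4 → PathFrom p f → Visits 4F f →
  testParity p f ≡ not (high p)
hitting-parity {n = zero} p f p<4 path (() , _)
hitting-parity {n = suc n} p f p<4 (p~y , path) visit
  with step-from-below p (head f) p<4 p~y
... | inj₂ (y≡4 , high-p) = trans (entering-top p f y≡4) (sym (cong not high-p))
... | inj₁ y<4 = begin
  testParity p f
    ≡⟨ sum-cong-≗ (λ k → parityStep-low (test k p) (rest k) (test-low k y y<4)) ⟩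
  ∑[ k < 4 ] (descent (test k p) (test k y) xor parityFrom (test k y) (test k ∘ tail f))
    ≡⟨ ∑-distrib-+ (λ k → descent (test k p) (test k y)) rest ⟩
  (∑[ k < 4 ] descent (test k p) (test k y)) xor testParity y (tail f)
    ≡⟨ cong₂ _xor_ (crossing p y p<4 y<4 p~y)
         (hitting-parity y (tail f) y<4 path (visits-tail f visit y≢4)) ⟩
  (high p xor high y) xor not (high y)
    ≡⟨ xor-not-cancel (high p) (high y) ⟩
  not (high p) ∎
  where
  open ≡-Reasoning
  y = head f
  rest : Vector Bool 4
  rest k = parityFrom (test k y) (test k ∘ tail f)
  y≢4 : y ≢ 4F
  y≢4 y≡4 = <-irrefl (cong toℕ y≡4) y<4

sum-four-equal : ∀ {b} (g : Vector Bool 4) → (∀ k → g k ≡ b) → sum g ≡ false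
sum-four-equal {b} g g≡b = trans (sum-cong-≗ g≡b) (four-copies b)
  where
  four-copies : ∀ b → b xor (b xor (b xor (b xor false))) ≡ false
  four-copies false = refl
  four-copies true  = refl

theorem7p5 : ∀ (M : ℕ) → M ≥ 3 →
    Σ ((Fin M → Fin 3) → Fin 2) λ c →
      ∀ (t : Fin M → Fin 6) → IsWalk t → ¬ Monochromatic c t
theorem7p5 M _ = colour , not-monochromatic
  where
  not-monochromatic : ∀ t → IsWalk t → ¬ Monochromatic colour t
  not-monochromatic t t-walk mono with trans (sym odd) even
    where
    odd : testParity 0F t ≡ true
    odd = hitting-parity 0F t (s≤s z≤n) (walk⇒path t-walk) (IsWalk.onto t-walk 4F)
    even : testParity 0F t ≡ false
    even = sum-four-equal _ (λ k →
      fromBool-injective (mono (test k) (test 0F) (test-walk k) (test-walk 0F)))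
  ... | ()
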